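{- Let $M=(V,D)$ be a vf-closed $\Delta$-matroid and $n=|V|$. Then $q_1(M)(-2)=(-1)^n(-2)^{d_{M\,\bar{*}\,V}}$.
   Context: A set system is $M=(V,D)$ with $V$ finite, $D$ a family of subsets of $V$; write $Z\in M$ for $Z\in D$; proper means $D\neq\emptyset$. $\oplus$ is symmetric difference. Pivot: $M*X=(V,\{Z\oplus X:Z\in D\})$; loop complementation: $M+w=(V,D\oplus\{Z\cup\{w\}:Z\in D,w\notin Z\})$; operations are applied left to right; dual pivot $M\,\bar{*}\,w=M+w*w+w$; operations on distinct elements commute, and $M\,\bar{*}\,V$ denotes applying $\bar{*}\,w$ for all $w\in V$. For proper $M$, $d_M(X)=\min\{|X\oplus Z|:Z\in M\}$, $d_M=d_M(\emptyset)$, and $q_1(M)(y)=\sum_{X\subseteq V}y^{d_{M*X}}$. A $\Delta$-matroid is a proper set system such that for all $X,Y\in M$ and $w\in X\oplus Y$, either $X\oplus\{w\}\in M$ or some $v\in X\oplus Y$, $v\neq w$, has $X\oplus\{w,v\}\in M$. $M$ is a vf-closed $\Delta$-matroid if $M\varphi$ is a $\Delta$-matroid for every sequence $\varphi$ of pivots and loop complementations on elements of $V$. -}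

module Defs where

open import Data.Nat as ℕ using (ℕ; zero; suc)
open import Data.Bool using (Bool; true; false; _xor_; _∧_; not; if_then_else_)
open import Data.Fin using (Fin)
open import Data.Fin.Subset using (Subset; ⁅_⁆; ∣_∣)
open import Data.Vec using (Vec; []; _∷_; zipWith; lookup; _[_]≔_)
open import Data.List using (List; []; _∷_; map; _++_; foldr; allFin)
open import Data.Integer as ℤ using (ℤ)
open import Data.Product using (Σ; _×_; ∃; _,_)
open import Data.Sum using (_⊎_)
open import Relation.Binary.PropositionalEquality using (_≡_; _≢_)

_⊕_ : ∀ {n} → Subset n → Subset n → Subset n
_⊕_ = zipWith _xor_

_==_ : ∀ {n} → Subset n → Subset n → Bool
[] == [] = true
(a ∷ as) == (b ∷ bs) = not (a xor b) ∧ (as == bs)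

allSubsets : (n : ℕ) → List (Subset n)
allSubsets zero = [] ∷ []
allSubsets (suc n) = map (false ∷_) (allSubsets n) ++ map (true ∷_) (allSubsets n)

SetSystem : ℕ → Set
SetSystem n = Subset n → Bool

_∈M_ : ∀ {n} → Subset n → SetSystem n → Set
Z ∈M M = M Z ≡ true

Proper : ∀ {n} → SetSystem n → Set
Proper {n} M = ∃ λ (Z : Subset n) → Z ∈M M

_*ₛ_ : ∀ {n} → SetSystem n → Subset n → SetSystem n
(M *ₛ X) Z = M (Z ⊕ X)

-- loop complementation  M + w = D ⊕ {Z ∪ {w} : Z ∈ D, w ∉ Z}
-- Z lies in the second family iff w ∈ Z and Z \ {w} ∈ D.
_+ₗ_ : ∀ {n} → SetSystem n → Fin n → SetSystem n
(M +ₗ w) Z = M Z xor (lookup Z w ∧ M (Z [ w ]≔ false))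

_∗̄_ : ∀ {n} → SetSystem n → Fin n → SetSystem n
M ∗̄ w = ((M +ₗ w) *ₛ ⁅ w ⁆) +ₗ w

_∗̄V : ∀ {n} → SetSystem n → SetSystem n
_∗̄V {n} M = foldr (λ w N → N ∗̄ w) M (allFin n)

minL : ℕ → List ℕ → ℕ
minL d [] = d
minL d (x ∷ xs) = foldr ℕ._⊓_ x xs

-- d_M(X) = min { |X ⊕ Z| : Z ∈ M }  (meaningful for proper M)
dist : ∀ {n} → SetSystem n → Subset n → ℕ
dist {n} M X = minL n (Data.List.mapMaybe f (allSubsets n))
  where
  open import Data.Maybe using (Maybe; just; nothing)
  f : Subset n → Maybe ℕ
  f Z = if M Z then just ∣ X ⊕ Z ∣ else nothing

d : ∀ {n} → SetSystem n → ℕ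
d {n} M = dist M (Data.Vec.replicate n false)

q₁ : ∀ {n} → SetSystem n → ℤ → ℤ
q₁ {n} M y = foldr ℤ._+_ (ℤ.+ 0) (map (λ X → y ℤ.^ d (M *ₛ X)) (allSubsets n))

IsΔMatroid : ∀ {n} → SetSystem n → Set
IsΔMatroid {n} M =
  Proper M ×
  (∀ (X Y : Subset n) → X ∈M M → Y ∈M M → (w : Fin n) → lookup (X ⊕ Y) w ≡ true →
     ((X ⊕ ⁅ w ⁆) ∈M M) ⊎
     (∃ λ (v : Fin n) → lookup (X ⊕ Y) v ≡ true × v ≢ w × ((X ⊕ (⁅ w ⁆ ⊕ ⁅ v ⁆)) ∈M M)))

data Op (n : ℕ) : Set where
  piv  : Fin n → Op n
  loop : Fin n → Op n

applyOp : ∀ {n} → SetSystem n → Op n → SetSystem n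
applyOp M (piv w) = M *ₛ ⁅ w ⁆
applyOp M (loop w) = M +ₗ w

apply : ∀ {n} → SetSystem n → List (Op n) → SetSystem n
apply M [] = M
apply M (o ∷ os) = apply (applyOp M o) os

IsVfClosedΔMatroid : ∀ {n} → SetSystem n → Set
IsVfClosedΔMatroid {n} M = ∀ (φ : List (Op n)) → IsΔMatroid (apply M φ)

-- Induct on n by splitting on the element 0 into the deletion M∖0 and the contraction M/0.  In a
-- Δ-matroid the minimum sizes of the two slices differ by at most one, which makes d_{M*X} the
-- minimum size of the slice selected by X, so q₁ M = q₁ (M∖0) + q₁ (M/0) (with a factor 1 + y if
-- one slice is empty).  On the other side, M ∗̄ V = Q ∗̄ 0 where Q (dual pivots on the other
-- elements) has slices (M∖0) ∗̄ V and (M/0) ∗̄ V, and Q ∗̄ 0 has slices Q∖0 ⊻ Q/0 and Q/0.  If the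
-- slices of Q have different minimum sizes a ≠ b, d (Q ∗̄ 0) = min(a, b); if a = b, the exchange
-- axiom forces Q∖0 and Q/0 to agree on all sets of size a, so d (Q ∗̄ 0) = a + 1.  Either way
-- (-2)^a + (-2)^b = -(-2)^{d (Q ∗̄ 0)}.
module Submission where

open import Defs
open import Data.Nat using (ℕ)
open import Data.Integer using (ℤ; -[1+_]; _*_; _^_)
open import Relation.Binary.PropositionalEquality using (_≡_)

open import Data.Bool using (Bool; true; false; not; _xor_; _∧_; if_then_else_)
open import Data.Bool.Properties
  using (xor-assoc; xor-comm; xor-same; xor-identityˡ; xor-identityʳ; ∧-zeroʳ; not-involutive; ⇔→≡; ¬-not)
open import Data.Empty using (⊥-elim)
open import Data.Fin using (Fin; zero; suc)
open import Data.Fin.Subset using (Subset; ⁅_⁆; ∣_∣) renaming (⊥ to ∅)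
open import Data.Fin.Subset.Properties using (x∈⁅y⁆⇒x≡y)
open import Data.Integer as ℤ using (_+_; -_; 1ℤ)
import Data.Integer.Properties as ℤ
open import Data.Integer.Tactic.RingSolver using (solve-∀)
open import Data.List using (List; []; _∷_; map; _++_; foldr; mapMaybe; tabulate; allFin)
open import Data.List.Membership.Propositional using (_∈_)
open import Data.List.Membership.Propositional.Properties using (∈-map⁺; ∈-++⁺ˡ; ∈-++⁺ʳ)
open import Data.List.Properties using (map-cong; map-∘; map-tabulate)
open import Data.List.Relation.Unary.Any using (here; there)
open import Data.Maybe using (Maybe; just; nothing)
open import Data.Nat as ℕ using (zero; suc; _≤_; _<_; _⊓_; s≤s)
open import Data.Nat.Induction using (<-wellFounded)
open import Data.Nat.Properties as ℕ
  using (≤-refl; ≤-trans; ≤-reflexive; m≤n⇒m≤1+n; ≤∧≢⇒<; <⇒≤; <-irrefl; <-cmp; ⊓-sel;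
         m⊓n≤m; m⊓n≤n; m≤n⇒m⊓n≡m; m≥n⇒m⊓n≡n)
open import Data.Product using (∃; _×_; _,_; proj₁; proj₂)
open import Data.Sum using (_⊎_; inj₁; inj₂)
open import Data.Vec using ([]; _∷_; lookup; _[_]≔_)
open import Data.Vec.Properties
  using (zipWith-assoc; zipWith-comm; zipWith-identityˡ; zipWith-identityʳ; lookup-zipWith;
         lookup∘update; lookup⇒[]=)
open import Function using (_∘_; mk⇔)
open import Induction.WellFounded using (Acc; acc)
open import Relation.Binary.Definitions using (tri<; tri≈; tri>)
open import Relation.Binary.PropositionalEquality
  using (_≢_; _≗_; refl; sym; trans; cong; cong₂; subst; module ≡-Reasoning)
open import Relation.Nullary using (¬_; yes; no)

private
  variable
    n a b k : ℕ

true≢false : true ≢ false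
true≢false ()

-- Symmetric difference

⊕-assoc : (X Y Z : Subset n) → (X ⊕ Y) ⊕ Z ≡ X ⊕ (Y ⊕ Z)
⊕-assoc = zipWith-assoc xor-assoc

⊕-comm : (X Y : Subset n) → X ⊕ Y ≡ Y ⊕ X
⊕-comm = zipWith-comm xor-comm

⊕-identityˡ : (X : Subset n) → ∅ ⊕ X ≡ X
⊕-identityˡ = zipWith-identityˡ xor-identityˡ

⊕-identityʳ : (X : Subset n) → X ⊕ ∅ ≡ X
⊕-identityʳ = zipWith-identityʳ xor-identityʳ

⊕-self : (X : Subset n) → X ⊕ X ≡ ∅
⊕-self []      = refl
⊕-self (x ∷ X) = cong₂ _∷_ (xor-same x) (⊕-self X)

⊕-cancelʳ : (X S : Subset n) → (X ⊕ S) ⊕ S ≡ X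
⊕-cancelʳ X S = trans (⊕-assoc X S S) (trans (cong (X ⊕_) (⊕-self S)) (⊕-identityʳ X))

lookup-⊕ : (X Y : Subset n) (i : Fin n) → lookup (X ⊕ Y) i ≡ lookup X i xor lookup Y i
lookup-⊕ X Y i = lookup-zipWith _xor_ i X Y

lookup-⁅⁆-≢ : {i j : Fin n} → j ≢ i → lookup ⁅ i ⁆ j ≡ false
lookup-⁅⁆-≢ {i = i} {j} j≢i = ¬-not (j≢i ∘ x∈⁅y⁆⇒x≡y i ∘ lookup⇒[]= j ⁅ i ⁆)

lookup-⊕⁅⁆-≢ : (Z : Subset n) {u w : Fin n} → u ≢ w → lookup (Z ⊕ ⁅ w ⁆) u ≡ lookup Z u
lookup-⊕⁅⁆-≢ Z {u} {w} u≢w = begin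
  lookup (Z ⊕ ⁅ w ⁆) u         ≡⟨ lookup-⊕ Z ⁅ w ⁆ u ⟩
  lookup Z u xor lookup ⁅ w ⁆ u ≡⟨ cong (lookup Z u xor_) (lookup-⁅⁆-≢ u≢w) ⟩
  lookup Z u xor false         ≡⟨ xor-identityʳ _ ⟩
  lookup Z u                   ∎
  where open ≡-Reasoning

∣⊕⁅⁆∣-remove : (Z : Subset n) (w : Fin n) → lookup Z w ≡ true → suc ∣ Z ⊕ ⁅ w ⁆ ∣ ≡ ∣ Z ∣
∣⊕⁅⁆∣-remove (true  ∷ Z) zero    _  = cong (suc ∘ ∣_∣) (⊕-identityʳ Z)
∣⊕⁅⁆∣-remove (true  ∷ Z) (suc w) Zw = cong suc (∣⊕⁅⁆∣-remove Z w Zw)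
∣⊕⁅⁆∣-remove (false ∷ Z) (suc w) Zw = ∣⊕⁅⁆∣-remove Z w Zw

∣⊕⁅⁆∣-insert : (Z : Subset n) (w : Fin n) → lookup Z w ≡ false → ∣ Z ⊕ ⁅ w ⁆ ∣ ≡ suc ∣ Z ∣
∣⊕⁅⁆∣-insert (false ∷ Z) zero    _  = cong (suc ∘ ∣_∣) (⊕-identityʳ Z)
∣⊕⁅⁆∣-insert (true  ∷ Z) (suc w) Zw = cong suc (∣⊕⁅⁆∣-insert Z w Zw)
∣⊕⁅⁆∣-insert (false ∷ Z) (suc w) Zw = ∣⊕⁅⁆∣-insert Z w Zw

∣⊕⁅⁆∣≤ : (Z : Subset n) (w : Fin n) → ∣ Z ⊕ ⁅ w ⁆ ∣ ≤ suc ∣ Z ∣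
∣⊕⁅⁆∣≤ Z w with lookup Z w in Zw
... | true  = m≤n⇒m≤1+n (<⇒≤ (≤-reflexive (∣⊕⁅⁆∣-remove Z w Zw)))
... | false = ≤-reflexive (∣⊕⁅⁆∣-insert Z w Zw)

∣⊕⁅⁆⊕⁅⁆∣-remove : (Z : Subset n) {u w : Fin n} → u ≢ w → lookup Z w ≡ true → lookup Z u ≡ true →
                   suc (suc ∣ Z ⊕ (⁅ w ⁆ ⊕ ⁅ u ⁆) ∣) ≡ ∣ Z ∣
∣⊕⁅⁆⊕⁅⁆∣-remove Z {u} {w} u≢w Zw Zu = begin
  suc (suc ∣ Z ⊕ (⁅ w ⁆ ⊕ ⁅ u ⁆) ∣) ≡⟨ cong (λ U → suc (suc ∣ U ∣)) (sym (⊕-assoc Z ⁅ w ⁆ ⁅ u ⁆)) ⟩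
  suc (suc ∣ (Z ⊕ ⁅ w ⁆) ⊕ ⁅ u ⁆ ∣) ≡⟨ cong suc (∣⊕⁅⁆∣-remove (Z ⊕ ⁅ w ⁆) u (trans (lookup-⊕⁅⁆-≢ Z u≢w) Zu)) ⟩
  suc ∣ Z ⊕ ⁅ w ⁆ ∣                 ≡⟨ ∣⊕⁅⁆∣-remove Z w Zw ⟩
  ∣ Z ∣                             ∎
  where open ≡-Reasoning

∣⊕⁅⁆⊕⁅⁆∣-exchange : (Z : Subset n) {u w : Fin n} → u ≢ w → lookup Z w ≡ true → lookup Z u ≡ false →
                     ∣ Z ⊕ (⁅ w ⁆ ⊕ ⁅ u ⁆) ∣ ≡ ∣ Z ∣
∣⊕⁅⁆⊕⁅⁆∣-exchange Z {u} {w} u≢w Zw Zu = begin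
  ∣ Z ⊕ (⁅ w ⁆ ⊕ ⁅ u ⁆) ∣ ≡⟨ cong ∣_∣ (sym (⊕-assoc Z ⁅ w ⁆ ⁅ u ⁆)) ⟩
  ∣ (Z ⊕ ⁅ w ⁆) ⊕ ⁅ u ⁆ ∣ ≡⟨ ∣⊕⁅⁆∣-insert (Z ⊕ ⁅ w ⁆) u (trans (lookup-⊕⁅⁆-≢ Z u≢w) Zu) ⟩
  suc ∣ Z ⊕ ⁅ w ⁆ ∣       ≡⟨ ∣⊕⁅⁆∣-remove Z w Zw ⟩
  ∣ Z ∣                   ∎
  where open ≡-Reasoning

∣p∣≤∣q∣⇒p≡q⊎∃∈q∖p : (S T : Subset n) → ∣ S ∣ ≤ ∣ T ∣ →
                    S ≡ T ⊎ ∃ λ w → lookup T w ≡ true × lookup S w ≡ false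
∣p∣≤∣q∣⇒p≡q⊎∃∈q∖p []          []          _   = inj₁ refl
∣p∣≤∣q∣⇒p≡q⊎∃∈q∖p (false ∷ S) (true  ∷ T) _   = inj₂ (zero , refl , refl)
∣p∣≤∣q∣⇒p≡q⊎∃∈q∖p (false ∷ S) (false ∷ T) S≤T with ∣p∣≤∣q∣⇒p≡q⊎∃∈q∖p S T S≤T
... | inj₁ refl              = inj₁ refl
... | inj₂ (w , Tw , Sw)     = inj₂ (suc w , Tw , Sw)
∣p∣≤∣q∣⇒p≡q⊎∃∈q∖p (true ∷ S)  (true ∷ T)  (s≤s S≤T) with ∣p∣≤∣q∣⇒p≡q⊎∃∈q∖p S T S≤T
... | inj₁ refl              = inj₁ refl
... | inj₂ (w , Tw , Sw)     = inj₂ (suc w , Tw , Sw)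
∣p∣≤∣q∣⇒p≡q⊎∃∈q∖p (true ∷ S)  (false ∷ T) S<T with ∣p∣≤∣q∣⇒p≡q⊎∃∈q∖p S T (<⇒≤ S<T)
... | inj₁ refl              = ⊥-elim (<-irrefl refl S<T)
... | inj₂ (w , Tw , Sw)     = inj₂ (suc w , Tw , Sw)

-- Minimum sizes

record MinSize (N : SetSystem n) (k : ℕ) : Set where
  constructor minSize
  field
    witness  : Subset n
    witness∈ : witness ∈M N
    ∣witness∣ : ∣ witness ∣ ≡ k
    minimal  : ∀ {Z} → Z ∈M N → k ≤ ∣ Z ∣

  <⇒∉ : ∀ {Z} → ∣ Z ∣ < k → ¬ Z ∈M N
  <⇒∉ Z<k Z∈ = <-irrefl refl (≤-trans Z<k (minimal Z∈))

open MinSize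

MinSize-unique : {N : SetSystem n} → MinSize N a → MinSize N b → a ≡ b
MinSize-unique (minSize W W∈ ∣W∣ W-min) (minSize V V∈ ∣V∣ V-min) =
  ℕ.≤-antisym (subst (_ ≤_) ∣V∣ (W-min V∈)) (subst (_ ≤_) ∣W∣ (V-min W∈))

MinSize-cong : {N N′ : SetSystem n} → N ≗ N′ → MinSize N k → MinSize N′ k
MinSize-cong N≗N′ (minSize W W∈ ∣W∣ W-min) =
  minSize W (trans (sym (N≗N′ W)) W∈) ∣W∣ (W-min ∘ trans (N≗N′ _))

foldr-⊓-≤ : ∀ x xs {y} → y ∈ x ∷ xs → foldr _⊓_ x xs ≤ y
foldr-⊓-≤ x []       (here refl)         = ≤-refl
foldr-⊓-≤ x (z ∷ zs) (here refl)         = ≤-trans (m⊓n≤n z _) (foldr-⊓-≤ x zs (here refl))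
foldr-⊓-≤ x (z ∷ zs) (there (here refl)) = m⊓n≤m z _
foldr-⊓-≤ x (z ∷ zs) (there (there y∈))  = ≤-trans (m⊓n≤n z _) (foldr-⊓-≤ x zs (there y∈))

foldr-⊓-∈ : ∀ x xs → foldr _⊓_ x xs ∈ x ∷ xs
foldr-⊓-∈ x []       = here refl
foldr-⊓-∈ x (z ∷ zs) with ⊓-sel z (foldr _⊓_ x zs)
... | inj₁ ≡z = subst (_∈ x ∷ z ∷ zs) (sym ≡z) (there (here refl))
... | inj₂ ≡m with foldr-⊓-∈ x zs
...   | here  m≡x = here (trans ≡m m≡x)
...   | there m∈  = there (there (subst (_∈ zs) (sym ≡m) m∈))

allSubsets-complete : (Z : Subset n) → Z ∈ allSubsets n
allSubsets-complete []          = here refl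
allSubsets-complete (false ∷ Z) = ∈-++⁺ˡ (∈-map⁺ (false ∷_) (allSubsets-complete Z))
allSubsets-complete {suc n} (true ∷ Z) =
  ∈-++⁺ʳ (map (false ∷_) (allSubsets n)) (∈-map⁺ (true ∷_) (allSubsets-complete Z))

∈-mapMaybe⁺ : {A : Set} (p : A → Maybe ℕ) {x : A} {xs : List A} {y : ℕ} →
              x ∈ xs → p x ≡ just y → y ∈ mapMaybe p xs
∈-mapMaybe⁺ p {xs = x ∷ xs} (here refl) px≡ rewrite px≡ = here refl
∈-mapMaybe⁺ p {xs = x′ ∷ xs} (there x∈) px≡ with p x′
... | just _  = there (∈-mapMaybe⁺ p x∈ px≡)
... | nothing = ∈-mapMaybe⁺ p x∈ px≡

∈-mapMaybe⁻ : {A : Set} (p : A → Maybe ℕ) (xs : List A) {y : ℕ} →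
              y ∈ mapMaybe p xs → ∃ λ x → p x ≡ just y
∈-mapMaybe⁻ p (x ∷ xs) y∈ with p x in px≡
∈-mapMaybe⁻ p (x ∷ xs) (here refl) | just _ = x , px≡
∈-mapMaybe⁻ p (x ∷ xs) (there y∈)  | just _ = ∈-mapMaybe⁻ p xs y∈
... | nothing = ∈-mapMaybe⁻ p xs y∈

minL-≤ : ∀ k {ys y} → y ∈ ys → minL k ys ≤ y
minL-≤ k {x ∷ xs} y∈ = foldr-⊓-≤ x xs y∈

minL-∈ : ∀ k {ys y} → y ∈ ys → minL k ys ∈ ys
minL-∈ k {x ∷ xs} _ = foldr-⊓-∈ x xs

module _ (N : SetSystem n) where

  -- definitionally the map minimised in dist N ∅
  private
    size? : Subset n → Maybe ℕ
    size? Z = if N Z then just ∣ ∅ ⊕ Z ∣ else nothing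

    size?-just : ∀ {Z} → Z ∈M N → size? Z ≡ just ∣ ∅ ⊕ Z ∣
    size?-just Z∈ rewrite Z∈ = refl

    size?-just⁻ : ∀ Z {k} → size? Z ≡ just k → Z ∈M N × ∣ ∅ ⊕ Z ∣ ≡ k
    size?-just⁻ Z eq with N Z
    size?-just⁻ Z refl | true = refl , refl

    size∈ : ∀ {Z} → Z ∈M N → ∣ ∅ ⊕ Z ∣ ∈ mapMaybe size? (allSubsets n)
    size∈ {Z} Z∈ = ∈-mapMaybe⁺ size? (allSubsets-complete Z) (size?-just Z∈)

  d-minSize : Proper N → MinSize N (d N)
  d-minSize (Z₀ , Z₀∈) with ∈-mapMaybe⁻ size? (allSubsets n) (minL-∈ n (size∈ Z₀∈))
  ... | W , eq with size?-just⁻ W eq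
  ...   | W∈ , ∣W∣ = minSize W W∈ (trans (cong ∣_∣ (sym (⊕-identityˡ W))) ∣W∣) d≤
    where
    d≤ : ∀ {Z} → Z ∈M N → d N ≤ ∣ Z ∣
    d≤ {Z} Z∈ = subst (d N ≤_) (cong ∣_∣ (⊕-identityˡ Z)) (minL-≤ n (size∈ Z∈))

  d-unique : MinSize N k → d N ≡ k
  d-unique h = MinSize-unique (d-minSize (witness h , witness∈ h)) h

-- Slicing off the element 0

slice : Bool → SetSystem (suc n) → SetSystem n
slice b N Z = N (b ∷ Z)

deletion contraction : SetSystem (suc n) → SetSystem n
deletion    = slice false
contraction = slice true

IsEmpty : SetSystem n → Set
IsEmpty {n} N = ∀ (Z : Subset n) → N Z ≡ false

decProper : (N : SetSystem n) → Proper N ⊎ IsEmpty N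
decProper {zero} N with N [] in N[]
... | true  = inj₁ ([] , N[])
... | false = inj₂ λ { [] → N[] }
decProper {suc n} N with decProper (deletion N) | decProper (contraction N)
... | inj₁ (Z , Z∈) | _             = inj₁ (false ∷ Z , Z∈)
... | inj₂ _        | inj₁ (Z , Z∈) = inj₁ (true ∷ Z , Z∈)
... | inj₂ N∖0=∅    | inj₂ N/0=∅    = inj₂ λ { (false ∷ Z) → N∖0=∅ Z ; (true ∷ Z) → N/0=∅ Z }

IsEmpty⇒¬Proper : {N : SetSystem n} → IsEmpty N → ¬ Proper N
IsEmpty⇒¬Proper N=∅ (Z , Z∈) = true≢false (trans (sym Z∈) (N=∅ Z))

slices-empty⇒¬Proper : {N : SetSystem (suc n)} →
                        IsEmpty (deletion N) → IsEmpty (contraction N) → ¬ Proper N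
slices-empty⇒¬Proper N∖0=∅ _    (false ∷ Z , Z∈) = IsEmpty⇒¬Proper N∖0=∅ (Z , Z∈)
slices-empty⇒¬Proper _    N/0=∅ (true ∷ Z , Z∈)  = IsEmpty⇒¬Proper N/0=∅ (Z , Z∈)

MinSize-via-deletion : {N : SetSystem (suc n)} → MinSize (deletion N) a →
                       (∀ {Z} → Z ∈M contraction N → a ≤ suc ∣ Z ∣) → MinSize N a
MinSize-via-deletion {N = N} (minSize W W∈ ∣W∣ W-min) N/0-large = minSize (false ∷ W) W∈ ∣W∣ min
  where
  min : ∀ {Z} → Z ∈M N → _ ≤ ∣ Z ∣
  min {false ∷ Z} = W-min
  min {true ∷ Z}  = N/0-large

MinSize-via-contraction : {N : SetSystem (suc n)} → MinSize (contraction N) a →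
                          (∀ {Z} → Z ∈M deletion N → suc a ≤ ∣ Z ∣) → MinSize N (suc a)
MinSize-via-contraction {N = N} (minSize W W∈ ∣W∣ W-min) N∖0-large =
  minSize (true ∷ W) W∈ (cong suc ∣W∣) min
  where
  min : ∀ {Z} → Z ∈M N → _ ≤ ∣ Z ∣
  min {false ∷ Z} = N∖0-large
  min {true ∷ Z}  = s≤s ∘ W-min

_⊻_ : SetSystem n → SetSystem n → SetSystem n
(A ⊻ B) Z = A Z xor B Z

⊻-comm : (A B : SetSystem n) → A ⊻ B ≗ B ⊻ A
⊻-comm A B Z = xor-comm (A Z) (B Z)

MinSize-⊻-< : {A B : SetSystem n} → MinSize A a → MinSize B b → a < b → MinSize (A ⊻ B) a
MinSize-⊻-< {a = a} {b = b} {A = A} {B} (minSize W W∈A ∣W∣ A-min) B-size a<b =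
  minSize W W∈A⊻B ∣W∣ min
  where
  W∉B : B W ≡ false
  W∉B = ¬-not (<⇒∉ B-size (subst (_< b) (sym ∣W∣) a<b))
  W∈A⊻B : W ∈M (A ⊻ B)
  W∈A⊻B = cong₂ _xor_ W∈A W∉B
  min : ∀ {Z} → Z ∈M (A ⊻ B) → a ≤ ∣ Z ∣
  min {Z} Z∈ with A Z in Z∈A
  ... | true  = A-min Z∈A
  ... | false = ≤-trans (<⇒≤ a<b) (minimal B-size Z∈)

MinSize-⊻ : {A B : SetSystem n} → MinSize A a → MinSize B b → a ≢ b → MinSize (A ⊻ B) (a ⊓ b)
MinSize-⊻ {a = a} {b} {A} {B} A-size B-size a≢b with <-cmp a b
... | tri< a<b _ _ = subst (MinSize _) (sym (m≤n⇒m⊓n≡m (<⇒≤ a<b))) (MinSize-⊻-< A-size B-size a<b)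
... | tri≈ _ a≡b _ = ⊥-elim (a≢b a≡b)
... | tri> _ _ b<a = subst (MinSize _) (sym (m≥n⇒m⊓n≡n (<⇒≤ b<a)))
                       (MinSize-cong (⊻-comm B A) (MinSize-⊻-< B-size A-size b<a))

⊻-above-min : {A B : SetSystem n} → MinSize A a → MinSize B a →
              (∀ S → ∣ S ∣ ≡ a → A S ≡ B S) → ∀ {Z} → Z ∈M (A ⊻ B) → a < ∣ Z ∣
⊻-above-min {A = A} {B} A-size B-size agree {Z} Z∈ with A Z in Z∈A | B Z in Z∈B | Z∈
... | true  | false | _ =
  ≤∧≢⇒< (minimal A-size Z∈A) λ a≡ → true≢false (trans (sym Z∈A) (trans (agree Z (sym a≡)) Z∈B))
... | false | true  | _ =
  ≤∧≢⇒< (minimal B-size Z∈B) λ a≡ → true≢false (trans (sym Z∈B) (trans (sym (agree Z (sym a≡))) Z∈A))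

-- Δ-matroids

Exchange : SetSystem n → Set
Exchange {n} M = ∀ (X Y : Subset n) → X ∈M M → Y ∈M M → (w : Fin n) → lookup (X ⊕ Y) w ≡ true →
     ((X ⊕ ⁅ w ⁆) ∈M M) ⊎
     (∃ λ (v : Fin n) → lookup (X ⊕ Y) v ≡ true × v ≢ w × ((X ⊕ (⁅ w ⁆ ⊕ ⁅ v ⁆)) ∈M M))

Proper-pivot : {M : SetSystem n} (S : Subset n) → Proper M → Proper (M *ₛ S)
Proper-pivot {M = M} S (Z , Z∈) = Z ⊕ S , trans (cong M (⊕-cancelʳ Z S)) Z∈

IsEmpty-pivot : {M : SetSystem n} (S : Subset n) → IsEmpty M → IsEmpty (M *ₛ S)
IsEmpty-pivot S M=∅ Z = M=∅ (Z ⊕ S)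

Δ-pivot : {M : SetSystem n} (S : Subset n) → IsΔMatroid M → IsΔMatroid (M *ₛ S)
Δ-pivot {M = M} S (M-proper , exch) = Proper-pivot S M-proper , exch′
  where
  ⊕-swap : ∀ X A → (X ⊕ A) ⊕ S ≡ (X ⊕ S) ⊕ A
  ⊕-swap X A = trans (⊕-assoc X A S) (trans (cong (X ⊕_) (⊕-comm A S)) (sym (⊕-assoc X S A)))
  ⊕-shift : ∀ X Y → (X ⊕ S) ⊕ (Y ⊕ S) ≡ X ⊕ Y
  ⊕-shift X Y =
    trans (sym (⊕-assoc (X ⊕ S) Y S)) (trans (cong (_⊕ S) (sym (⊕-swap X Y))) (⊕-cancelʳ (X ⊕ Y) S))
  exch′ : Exchange (M *ₛ S)
  exch′ X Y X∈ Y∈ w Δw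
    with exch (X ⊕ S) (Y ⊕ S) X∈ Y∈ w (subst (λ T → lookup T w ≡ true) (sym (⊕-shift X Y)) Δw)
  ... | inj₁ h                 = inj₁ (trans (cong M (⊕-swap X ⁅ w ⁆)) h)
  ... | inj₂ (v , Δv , v≢w , h) =
    inj₂ (v , subst (λ T → lookup T v ≡ true) (⊕-shift X Y) Δv , v≢w , trans (cong M (⊕-swap X _)) h)

Δ-slice : {N : SetSystem (suc n)} (b : Bool) → IsΔMatroid N → Proper (slice b N) → IsΔMatroid (slice b N)
Δ-slice {N = N} b (_ , exch) N/b-proper = N/b-proper , exch′
  where
  -- pivoting on ⁅ suc w ⁆ leaves the head b as b xor false
  in-slice : ∀ {Z} → N ((b xor false) ∷ Z) ≡ true → Z ∈M slice b N
  in-slice {Z} = subst (λ c → N (c ∷ Z) ≡ true) (xor-identityʳ b)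
  exch′ : Exchange (slice b N)
  exch′ X Y X∈ Y∈ w Δw with exch (b ∷ X) (b ∷ Y) X∈ Y∈ (suc w) Δw
  ... | inj₁ h                        = inj₁ (in-slice h)
  ... | inj₂ (zero , Δ0 , _ , _)      = ⊥-elim (true≢false (trans (sym Δ0) (xor-same b)))
  ... | inj₂ (suc v , Δv , v≢w , h)   = inj₂ (v , Δv , v≢w ∘ cong suc , in-slice h)

deletion-pivot₀ : (N : SetSystem (suc n)) → deletion (N *ₛ ⁅ zero ⁆) ≗ contraction N
deletion-pivot₀ N Z = cong (contraction N) (⊕-identityʳ Z)

contraction-pivot₀ : (N : SetSystem (suc n)) → contraction (N *ₛ ⁅ zero ⁆) ≗ deletion N
contraction-pivot₀ N Z = cong (deletion N) (⊕-identityʳ Z)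

MinSize-contraction≤suc : {N : SetSystem (suc n)} → IsΔMatroid N →
                          MinSize (deletion N) a → MinSize (contraction N) b → b ≤ suc a
MinSize-contraction≤suc {a = a} {b = b} ΔN (minSize W W∈ ∣W∣ _) N/0-size
    with proj₂ ΔN (false ∷ W) (true ∷ witness N/0-size) W∈ (witness∈ N/0-size) zero refl
... | inj₁ h = m≤n⇒m≤1+n (subst (b ≤_) (trans (cong ∣_∣ (⊕-identityʳ W)) ∣W∣) (minimal N/0-size h))
... | inj₂ (zero , _ , 0≢0 , _) = ⊥-elim (0≢0 refl)
... | inj₂ (suc u , _ , _ , h) = begin
  b                     ≤⟨ minimal N/0-size h ⟩
  ∣ W ⊕ (∅ ⊕ ⁅ u ⁆) ∣   ≡⟨ cong (λ T → ∣ W ⊕ T ∣) (⊕-identityˡ ⁅ u ⁆) ⟩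
  ∣ W ⊕ ⁅ u ⁆ ∣         ≤⟨ ∣⊕⁅⁆∣≤ W u ⟩
  suc ∣ W ∣             ≡⟨ cong suc ∣W∣ ⟩
  suc a                 ∎
  where open ℕ.≤-Reasoning

MinSize-deletion≤suc : {N : SetSystem (suc n)} → IsΔMatroid N →
                       MinSize (deletion N) a → MinSize (contraction N) b → a ≤ suc b
MinSize-deletion≤suc {N = N} ΔN N∖0-size N/0-size =
  MinSize-contraction≤suc (Δ-pivot ⁅ zero ⁆ ΔN)
    (MinSize-cong (sym ∘ deletion-pivot₀ N) N/0-size) (MinSize-cong (sym ∘ contraction-pivot₀ N) N∖0-size)

module _ {R : SetSystem (suc n)} (ΔR : IsΔMatroid R)
         (R∖0-size : MinSize (deletion R) a) (R/0-size : MinSize (contraction R) a) where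

  private
    remove<a : (T : Subset n) (w : Fin n) → ∣ T ∣ ≡ a → lookup T w ≡ true → ∣ T ⊕ ⁅ w ⁆ ∣ < a
    remove<a T w ∣T∣ Tw = ≤-reflexive (trans (∣⊕⁅⁆∣-remove T w Tw) ∣T∣)

    -- Exchange between T ∈ R/0 and S ∈ R∖0 at w ∈ T ∖ S: every outcome except T - w + u with
    -- u ∈ S ∖ T drops below the common minimum size a.
    exchange-closer : ∀ {S T w} → S ∈M deletion R → T ∈M contraction R → ∣ T ∣ ≡ a →
                      lookup T w ≡ true → lookup S w ≡ false →
                      ∃ λ T′ → T′ ∈M contraction R × ∣ T′ ∣ ≡ a × ∣ S ⊕ T′ ∣ < ∣ S ⊕ T ∣
    exchange-closer {S} {T} {w} S∈ T∈ ∣T∣ Tw Sw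
      with proj₂ ΔR (true ∷ T) (false ∷ S) T∈ S∈ (suc w) (trans (lookup-⊕ T S w) (cong₂ _xor_ Tw Sw))
    ... | inj₁ h = ⊥-elim (<⇒∉ R/0-size (remove<a T w ∣T∣ Tw) h)
    ... | inj₂ (zero , _ , _ , h) =
      ⊥-elim (<⇒∉ R∖0-size (subst (λ U → ∣ T ⊕ U ∣ < a) (sym (⊕-identityʳ ⁅ w ⁆)) (remove<a T w ∣T∣ Tw))
                  h)
    ... | inj₂ (suc u , Δu , suc-u≢suc-w , h) with lookup T u in Tu
    ...   | true  = ⊥-elim (<⇒∉ R/0-size T-w-u<a h)
      where
      T-w-u<a : ∣ T ⊕ (⁅ w ⁆ ⊕ ⁅ u ⁆) ∣ < a
      T-w-u<a = ≤-trans (ℕ.n≤1+n _)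
                  (≤-reflexive (trans (∣⊕⁅⁆⊕⁅⁆∣-remove T (suc-u≢suc-w ∘ cong suc) Tw Tu) ∣T∣))
    ...   | false = T ⊕ (⁅ w ⁆ ⊕ ⁅ u ⁆) , h , trans (∣⊕⁅⁆⊕⁅⁆∣-exchange T u≢w Tw Tu) ∣T∣ , closer
      where
      u≢w : u ≢ w
      u≢w = suc-u≢suc-w ∘ cong suc
      Su : lookup S u ≡ true
      Su = trans (sym (cong (_xor lookup S u) Tu)) (trans (sym (lookup-⊕ T S u)) Δu)
      closer : ∣ S ⊕ (T ⊕ (⁅ w ⁆ ⊕ ⁅ u ⁆)) ∣ < ∣ S ⊕ T ∣
      closer = begin-strict
        ∣ S ⊕ (T ⊕ (⁅ w ⁆ ⊕ ⁅ u ⁆)) ∣       ≡⟨ cong ∣_∣ (sym (⊕-assoc S T _)) ⟩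
        ∣ (S ⊕ T) ⊕ (⁅ w ⁆ ⊕ ⁅ u ⁆) ∣       <⟨ ℕ.n<1+n _ ⟩
        suc ∣ (S ⊕ T) ⊕ (⁅ w ⁆ ⊕ ⁅ u ⁆) ∣   <⟨ ℕ.n<1+n _ ⟩
        suc (suc ∣ (S ⊕ T) ⊕ (⁅ w ⁆ ⊕ ⁅ u ⁆) ∣)
          ≡⟨ ∣⊕⁅⁆⊕⁅⁆∣-remove (S ⊕ T) u≢w (trans (lookup-⊕ S T w) (cong₂ _xor_ Sw Tw))
                                         (trans (lookup-⊕ S T u) (cong₂ _xor_ Su Tu)) ⟩
        ∣ S ⊕ T ∣                           ∎
        where open ℕ.≤-Reasoning

  deletion⊆contraction-at-min : ∀ {S} → S ∈M deletion R → ∣ S ∣ ≡ a → S ∈M contraction R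
  deletion⊆contraction-at-min {S} S∈ ∣S∣ =
    descend (witness R/0-size) (witness∈ R/0-size) (∣witness∣ R/0-size) (<-wellFounded _)
    where
    descend : ∀ T → T ∈M contraction R → ∣ T ∣ ≡ a → Acc _<_ ∣ S ⊕ T ∣ → S ∈M contraction R
    descend T T∈ ∣T∣ (acc rs) with ∣p∣≤∣q∣⇒p≡q⊎∃∈q∖p S T (≤-reflexive (trans ∣S∣ (sym ∣T∣)))
    ... | inj₁ refl          = T∈
    ... | inj₂ (w , Tw , Sw) with exchange-closer S∈ T∈ ∣T∣ Tw Sw
    ...   | T′ , T′∈ , ∣T′∣ , closer = descend T′ T′∈ ∣T′∣ (rs closer)

slices-agree-at-min : {R : SetSystem (suc n)} → IsΔMatroid R →
                      MinSize (deletion R) a → MinSize (contraction R) a →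
                      ∀ S → ∣ S ∣ ≡ a → deletion R S ≡ contraction R S
slices-agree-at-min {R = R} ΔR R∖0-size R/0-size S ∣S∣ = ⇔→≡ (mk⇔ ∖0⇒/0 /0⇒∖0)
  where
  ∖0⇒/0 : S ∈M deletion R → S ∈M contraction R
  ∖0⇒/0 S∈ = deletion⊆contraction-at-min ΔR R∖0-size R/0-size S∈ ∣S∣
  /0⇒∖0 : S ∈M contraction R → S ∈M deletion R
  /0⇒∖0 S∈ = trans (sym (contraction-pivot₀ R S))
    (deletion⊆contraction-at-min (Δ-pivot ⁅ zero ⁆ ΔR)
       (MinSize-cong (sym ∘ deletion-pivot₀ R) R/0-size) (MinSize-cong (sym ∘ contraction-pivot₀ R) R∖0-size)
       (trans (deletion-pivot₀ R S) S∈) ∣S∣)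

-- Elementary operations and dual pivots

+ₗ-outside : (M : SetSystem n) {w : Fin n} {Z : Subset n} → lookup Z w ≡ false → (M +ₗ w) Z ≡ M Z
+ₗ-outside M {Z = Z} Zw rewrite Zw = xor-identityʳ (M Z)

Proper-loop : {M : SetSystem n} (w : Fin n) → Proper M → Proper (M +ₗ w)
Proper-loop {M = M} w (Z , Z∈) with lookup Z w in Zw
... | false = Z , trans (+ₗ-outside M Zw) Z∈
... | true with M (Z [ w ]≔ false) in Z-w∈
...   | true  = Z [ w ]≔ false , trans (+ₗ-outside M (lookup∘update w Z false)) Z-w∈
...   | false = Z , trans (cong₂ (λ x y → M Z xor (x ∧ y)) Zw Z-w∈) (trans (xor-identityʳ (M Z)) Z∈)

IsEmpty-loop : {M : SetSystem n} (w : Fin n) → IsEmpty M → IsEmpty (M +ₗ w)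
IsEmpty-loop w M=∅ Z rewrite M=∅ Z | M=∅ (Z [ w ]≔ false) = ∧-zeroʳ (lookup Z w)

Proper-apply : {M : SetSystem n} (φ : List (Op n)) → Proper M → Proper (apply M φ)
Proper-apply []             M-proper = M-proper
Proper-apply (piv w ∷ φ)  M-proper = Proper-apply φ (Proper-pivot ⁅ w ⁆ M-proper)
Proper-apply (loop w ∷ φ) M-proper = Proper-apply φ (Proper-loop w M-proper)

apply-++ : (M : SetSystem n) (φ ψ : List (Op n)) → apply M (φ ++ ψ) ≡ apply (apply M φ) ψ
apply-++ M []      ψ = refl
apply-++ M (o ∷ φ) ψ = apply-++ (applyOp M o) φ ψ

dualPivots : SetSystem n → List (Fin n) → SetSystem n
dualPivots M = foldr (λ w N → N ∗̄ w) M

dualPivotOps : List (Fin n) → List (Op n)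
dualPivotOps []       = []
dualPivotOps (w ∷ ws) = dualPivotOps ws ++ (loop w ∷ piv w ∷ loop w ∷ [])

dualPivots-apply : (M : SetSystem n) (ws : List (Fin n)) → dualPivots M ws ≡ apply M (dualPivotOps ws)
dualPivots-apply M []       = refl
dualPivots-apply M (w ∷ ws) =
  trans (cong (_∗̄ w) (dualPivots-apply M ws)) (sym (apply-++ M (dualPivotOps ws) _))

Δ-dualPivots : {M : SetSystem n} → IsVfClosedΔMatroid M → ∀ ws → IsΔMatroid (dualPivots M ws)
Δ-dualPivots {M = M} vf ws = subst IsΔMatroid (sym (dualPivots-apply M ws)) (vf (dualPivotOps ws))

IsEmpty-dualPivots : {M : SetSystem n} (ws : List (Fin n)) → IsEmpty M → IsEmpty (dualPivots M ws)
IsEmpty-dualPivots []       M=∅ = M=∅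
IsEmpty-dualPivots (w ∷ ws) M=∅ =
  IsEmpty-loop w (IsEmpty-pivot ⁅ w ⁆ (IsEmpty-loop w (IsEmpty-dualPivots ws M=∅)))

liftOp : Op n → Op (suc n)
liftOp (piv w)  = piv (suc w)
liftOp (loop w) = loop (suc w)

slice-applyOp-lift : (b : Bool) (N : SetSystem (suc n)) (o : Op n) →
                     slice b (applyOp N (liftOp o)) ≡ applyOp (slice b N) o
slice-applyOp-lift false N (piv w)  = refl
slice-applyOp-lift true  N (piv w)  = refl
slice-applyOp-lift b     N (loop w) = refl

slice-apply-lift : (b : Bool) (N : SetSystem (suc n)) (φ : List (Op n)) →
                   slice b (apply N (map liftOp φ)) ≡ apply (slice b N) φ
slice-apply-lift b N []      = refl
slice-apply-lift b N (o ∷ φ) =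
  trans (slice-apply-lift b (applyOp N (liftOp o)) φ) (cong (λ K → apply K φ) (slice-applyOp-lift b N o))

vf-slice : {M : SetSystem (suc n)} (b : Bool) → IsVfClosedΔMatroid M → Proper (slice b M) →
           IsVfClosedΔMatroid (slice b M)
vf-slice {M = M} b vf M/b-proper φ = subst IsΔMatroid (slice-apply-lift b M φ)
  (Δ-slice b (vf (map liftOp φ)) (subst Proper (sym (slice-apply-lift b M φ)) (Proper-apply φ M/b-proper)))

slice-dualPivots-suc : (b : Bool) (M : SetSystem (suc n)) (ws : List (Fin n)) →
                       slice b (dualPivots M (map suc ws)) ≡ dualPivots (slice b M) ws
slice-dualPivots-suc b M []       = refl
slice-dualPivots-suc b M (w ∷ ws) =
  trans (slice-apply-lift b (dualPivots M (map suc ws)) (loop w ∷ piv w ∷ loop w ∷ []))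
        (cong (_∗̄ w) (slice-dualPivots-suc b M ws))

slice-dualPivots-others : (b : Bool) (M : SetSystem (suc n)) →
                          slice b (dualPivots M (tabulate suc)) ≡ slice b M ∗̄V
slice-dualPivots-others {n} b M =
  trans (cong (slice b ∘ dualPivots M) (sym (map-tabulate (λ i → i) suc)))
        (slice-dualPivots-suc b M (allFin n))

deletion-∗̄₀ : (N : SetSystem (suc n)) → deletion (N ∗̄ zero) ≗ deletion N ⊻ contraction N
deletion-∗̄₀ N Z rewrite ⊕-identityʳ Z =
  trans (xor-identityʳ _) (xor-comm (contraction N Z) (deletion N Z))

contraction-∗̄₀ : (N : SetSystem (suc n)) → contraction (N ∗̄ zero) ≗ contraction N
contraction-∗̄₀ N Z rewrite ⊕-identityʳ Z = cancel (deletion N Z) (contraction N Z)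
  where
  cancel : ∀ x y → (x xor false) xor (y xor x) ≡ y
  cancel false y = xor-identityʳ y
  cancel true  y = trans (cong not (xor-comm y true)) (not-involutive y)

-- The distance d through the slices

d≡d-deletion : {N : SetSystem (suc n)} → IsΔMatroid N → Proper (deletion N) → d N ≡ d (deletion N)
d≡d-deletion {N = N} ΔN N∖0-proper = d-unique N (MinSize-via-deletion N∖0-size N/0-large)
  where
  N∖0-size = d-minSize (deletion N) N∖0-proper
  N/0-large : ∀ {Z} → Z ∈M contraction N → d (deletion N) ≤ suc ∣ Z ∣
  N/0-large Z∈ = ≤-trans (MinSize-deletion≤suc ΔN N∖0-size N/0-size) (s≤s (minimal N/0-size Z∈))
    where N/0-size = d-minSize (contraction N) (_ , Z∈)

d≡suc-d-contraction : {N : SetSystem (suc n)} → IsEmpty (deletion N) → Proper (contraction N) →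
                      d N ≡ suc (d (contraction N))
d≡suc-d-contraction {N = N} N∖0=∅ N/0-proper =
  d-unique N (MinSize-via-contraction (d-minSize (contraction N) N/0-proper)
                                      (⊥-elim ∘ IsEmpty⇒¬Proper N∖0=∅ ∘ (_ ,_)))

d-∗̄₀-≢ : {N : SetSystem (suc n)} → MinSize (deletion N) a → MinSize (contraction N) b → a ≢ b →
         d (N ∗̄ zero) ≡ a ⊓ b
d-∗̄₀-≢ {a = a} {b = b} {N = N} N∖0-size N/0-size a≢b =
  d-unique (N ∗̄ zero)
    (MinSize-via-deletion (MinSize-cong (sym ∘ deletion-∗̄₀ N) (MinSize-⊻ N∖0-size N/0-size a≢b)) large)
  where
  large : ∀ {Z} → Z ∈M contraction (N ∗̄ zero) → a ⊓ b ≤ suc ∣ Z ∣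
  large {Z} Z∈ =
    m≤n⇒m≤1+n (≤-trans (m⊓n≤n a b) (minimal N/0-size (trans (sym (contraction-∗̄₀ N Z)) Z∈)))

d-∗̄₀-≡ : {N : SetSystem (suc n)} → IsΔMatroid N → MinSize (deletion N) a → MinSize (contraction N) a →
         d (N ∗̄ zero) ≡ suc a
d-∗̄₀-≡ {N = N} ΔN N∖0-size N/0-size =
  d-unique (N ∗̄ zero) (MinSize-via-contraction (MinSize-cong (sym ∘ contraction-∗̄₀ N) N/0-size) large)
  where
  large : ∀ {Z} → Z ∈M deletion (N ∗̄ zero) → _ ≤ ∣ Z ∣
  large {Z} Z∈ = ⊻-above-min N∖0-size N/0-size (slices-agree-at-min ΔN N∖0-size N/0-size)
                   (trans (sym (deletion-∗̄₀ N Z)) Z∈)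

d-∗̄₀-contraction-empty : {N : SetSystem (suc n)} → MinSize (deletion N) a → IsEmpty (contraction N) →
                         d (N ∗̄ zero) ≡ a
d-∗̄₀-contraction-empty {N = N} N∖0-size N/0=∅ =
  d-unique (N ∗̄ zero) (MinSize-via-deletion (MinSize-cong N∖0≗ N∖0-size) no-contraction)
  where
  no-contraction : ∀ {Z} → Z ∈M contraction (N ∗̄ zero) → _ ≤ suc ∣ Z ∣
  no-contraction {Z} Z∈ = ⊥-elim (IsEmpty⇒¬Proper N/0=∅ (Z , trans (sym (contraction-∗̄₀ N Z)) Z∈))
  N∖0≗ : deletion N ≗ deletion (N ∗̄ zero)
  N∖0≗ Z = sym (trans (deletion-∗̄₀ N Z) (trans (cong (deletion N Z xor_) (N/0=∅ Z)) (xor-identityʳ _)))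

d-∗̄₀-deletion-empty : {N : SetSystem (suc n)} → IsEmpty (deletion N) → MinSize (contraction N) b →
                      d (N ∗̄ zero) ≡ b
d-∗̄₀-deletion-empty {N = N} N∖0=∅ N/0-size =
  d-unique (N ∗̄ zero) (MinSize-via-deletion (MinSize-cong N/0≗ N/0-size) large)
  where
  N/0≗ : contraction N ≗ deletion (N ∗̄ zero)
  N/0≗ Z = sym (trans (deletion-∗̄₀ N Z) (cong (_xor contraction N Z) (N∖0=∅ Z)))
  large : ∀ {Z} → Z ∈M contraction (N ∗̄ zero) → _ ≤ suc ∣ Z ∣
  large {Z} Z∈ = m≤n⇒m≤1+n (minimal N/0-size (trans (sym (contraction-∗̄₀ N Z)) Z∈))

-- The polynomial q₁ through the slices

sumℤ : {A : Set} → (A → ℤ) → List A → ℤ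
sumℤ f xs = foldr _+_ (ℤ.+ 0) (map f xs)

module _ {A : Set} where

  sumℤ-++ : (f : A → ℤ) (xs ys : List A) → sumℤ f (xs ++ ys) ≡ sumℤ f xs + sumℤ f ys
  sumℤ-++ f []       ys = sym (ℤ.+-identityˡ _)
  sumℤ-++ f (x ∷ xs) ys = trans (cong (f x +_) (sumℤ-++ f xs ys)) (sym (ℤ.+-assoc (f x) _ _))

  sumℤ-map : {B : Set} (f : B → ℤ) (h : A → B) (xs : List A) → sumℤ f (map h xs) ≡ sumℤ (f ∘ h) xs
  sumℤ-map f h xs = cong (foldr _+_ (ℤ.+ 0)) (sym (map-∘ xs))

  sumℤ-cong : {f g : A → ℤ} → f ≗ g → (xs : List A) → sumℤ f xs ≡ sumℤ g xs
  sumℤ-cong f≗g xs = cong (foldr _+_ (ℤ.+ 0)) (map-cong f≗g xs)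

  sumℤ-+ : (f g : A → ℤ) (xs : List A) → sumℤ (λ x → f x + g x) xs ≡ sumℤ f xs + sumℤ g xs
  sumℤ-+ f g []       = refl
  sumℤ-+ f g (x ∷ xs) = trans (cong (f x + g x +_) (sumℤ-+ f g xs)) (interchange (f x) (g x) _ _)
    where
    interchange : ∀ p q r s → (p + q) + (r + s) ≡ (p + r) + (q + s)
    interchange = solve-∀

  sumℤ-*ˡ : (c : ℤ) (f : A → ℤ) (xs : List A) → sumℤ (λ x → c * f x) xs ≡ c * sumℤ f xs
  sumℤ-*ˡ c f []       = sym (ℤ.*-zeroʳ c)
  sumℤ-*ˡ c f (x ∷ xs) = trans (cong (c * f x +_) (sumℤ-*ˡ c f xs)) (sym (ℤ.*-distribˡ-+ c (f x) _))

sumℤ-allSubsets-suc : (f : Subset (suc n) → ℤ) →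
                      sumℤ f (allSubsets (suc n)) ≡ sumℤ (λ X → f (false ∷ X) + f (true ∷ X)) (allSubsets n)
sumℤ-allSubsets-suc {n} f = begin
  sumℤ f (map (false ∷_) (allSubsets n) ++ map (true ∷_) (allSubsets n))
    ≡⟨ sumℤ-++ f (map (false ∷_) (allSubsets n)) (map (true ∷_) (allSubsets n)) ⟩
  sumℤ f (map (false ∷_) (allSubsets n)) + sumℤ f (map (true ∷_) (allSubsets n))
    ≡⟨ cong₂ _+_ (sumℤ-map f (false ∷_) (allSubsets n)) (sumℤ-map f (true ∷_) (allSubsets n)) ⟩
  sumℤ (λ X → f (false ∷ X)) (allSubsets n) + sumℤ (λ X → f (true ∷ X)) (allSubsets n)
    ≡⟨ sym (sumℤ-+ _ _ (allSubsets n)) ⟩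
  sumℤ (λ X → f (false ∷ X) + f (true ∷ X)) (allSubsets n)
    ∎
  where open ≡-Reasoning

module _ {M : SetSystem (suc n)} (ΔM : IsΔMatroid M) (y : ℤ) where

  -- deletion (M *ₛ (b ∷ X)) and contraction (M *ₛ (b ∷ X)) are definitionally
  -- slice b M *ₛ X and slice (not b) M *ₛ X.
  private
    q₁-by-slices : ∀ {f g : Subset n → ℕ} →
                   (∀ X → d (M *ₛ (false ∷ X)) ≡ f X) → (∀ X → d (M *ₛ (true ∷ X)) ≡ g X) →
                   q₁ M y ≡ sumℤ (λ X → y ^ f X + y ^ g X) (allSubsets n)
    q₁-by-slices d≡f d≡g =
      trans (sumℤ-allSubsets-suc (λ X → y ^ d (M *ₛ X)))
            (sumℤ-cong (λ X → cong₂ (λ k l → y ^ k + y ^ l) (d≡f X) (d≡g X)) (allSubsets n))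

    geometric : ∀ k → y ^ k + y ^ suc k ≡ (1ℤ + y) * y ^ k
    geometric k = lemma y (y ^ k)
      where
      lemma : ∀ y p → p + y * p ≡ (1ℤ + y) * p
      lemma = solve-∀

  q₁-slices : Proper (deletion M) → Proper (contraction M) →
              q₁ M y ≡ q₁ (deletion M) y + q₁ (contraction M) y
  q₁-slices M∖0-proper M/0-proper = trans
    (q₁-by-slices (λ X → d≡d-deletion (Δ-pivot (false ∷ X) ΔM) (Proper-pivot X M∖0-proper))
                  (λ X → d≡d-deletion (Δ-pivot (true ∷ X) ΔM) (Proper-pivot X M/0-proper)))
    (sumℤ-+ _ _ (allSubsets n))

  q₁-contraction-empty : Proper (deletion M) → IsEmpty (contraction M) →
                         q₁ M y ≡ (1ℤ + y) * q₁ (deletion M) y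
  q₁-contraction-empty M∖0-proper M/0=∅ = begin
    q₁ M y
      ≡⟨ q₁-by-slices (λ X → d≡d-deletion (Δ-pivot (false ∷ X) ΔM) (Proper-pivot X M∖0-proper))
                      (λ X → d≡suc-d-contraction (IsEmpty-pivot X M/0=∅) (Proper-pivot X M∖0-proper)) ⟩
    sumℤ (λ X → y ^ d (deletion M *ₛ X) + y ^ suc (d (deletion M *ₛ X))) (allSubsets n)
      ≡⟨ sumℤ-cong (λ X → geometric (d (deletion M *ₛ X))) (allSubsets n) ⟩
    sumℤ (λ X → (1ℤ + y) * y ^ d (deletion M *ₛ X)) (allSubsets n)
      ≡⟨ sumℤ-*ˡ (1ℤ + y) _ (allSubsets n) ⟩
    (1ℤ + y) * q₁ (deletion M) y
      ∎
    where open ≡-Reasoning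

  q₁-deletion-empty : IsEmpty (deletion M) → Proper (contraction M) →
                      q₁ M y ≡ (1ℤ + y) * q₁ (contraction M) y
  q₁-deletion-empty M∖0=∅ M/0-proper = begin
    q₁ M y
      ≡⟨ q₁-by-slices (λ X → d≡suc-d-contraction (IsEmpty-pivot X M∖0=∅) (Proper-pivot X M/0-proper))
                      (λ X → d≡d-deletion (Δ-pivot (true ∷ X) ΔM) (Proper-pivot X M/0-proper)) ⟩
    sumℤ (λ X → y ^ suc (d (contraction M *ₛ X)) + y ^ d (contraction M *ₛ X)) (allSubsets n)
      ≡⟨ sumℤ-cong (λ X → trans (ℤ.+-comm (y ^ suc (d (contraction M *ₛ X))) _)
                                (geometric (d (contraction M *ₛ X))))
                   (allSubsets n) ⟩
    sumℤ (λ X → (1ℤ + y) * y ^ d (contraction M *ₛ X)) (allSubsets n)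
      ≡⟨ sumℤ-*ˡ (1ℤ + y) _ (allSubsets n) ⟩
    (1ℤ + y) * q₁ (contraction M) y
      ∎
    where open ≡-Reasoning

-- Evaluation at y = -2

pow-double : ∀ a → -[1+ 1 ] ^ a + -[1+ 1 ] ^ a ≡ - (-[1+ 1 ] ^ suc a)
pow-double a = lemma (-[1+ 1 ] ^ a)
  where
  lemma : ∀ p → p + p ≡ - (-[1+ 1 ] * p)
  lemma = solve-∀

pow-adjacent : a ≢ b → b ≤ suc a → a ≤ suc b → -[1+ 1 ] ^ a + -[1+ 1 ] ^ b ≡ - (-[1+ 1 ] ^ (a ⊓ b))
pow-adjacent {a} {b} a≢b b≤1+a a≤1+b with <-cmp a b
... | tri< a<b _ _ rewrite ℕ.≤-antisym b≤1+a a<b | m≤n⇒m⊓n≡m (ℕ.n≤1+n a) = lemma (-[1+ 1 ] ^ a)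
  where
  lemma : ∀ p → p + -[1+ 1 ] * p ≡ - p
  lemma = solve-∀
... | tri≈ _ a≡b _ = ⊥-elim (a≢b a≡b)
... | tri> _ _ b<a rewrite ℕ.≤-antisym a≤1+b b<a | m≥n⇒m⊓n≡n (ℕ.n≤1+n b) = lemma (-[1+ 1 ] ^ b)
  where
  lemma : ∀ p → -[1+ 1 ] * p + p ≡ - p
  lemma = solve-∀

pow-d-∗̄₀ : {N : SetSystem (suc n)} → IsΔMatroid N → MinSize (deletion N) a → MinSize (contraction N) b →
           -[1+ 1 ] ^ a + -[1+ 1 ] ^ b ≡ - (-[1+ 1 ] ^ d (N ∗̄ zero))
pow-d-∗̄₀ {a = a} {b = b} {N = N} ΔN N∖0-size N/0-size with a ℕ.≟ b
... | yes refl = trans (pow-double a) (cong (λ k → - (-[1+ 1 ] ^ k)) (sym (d-∗̄₀-≡ ΔN N∖0-size N/0-size)))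
... | no a≢b   = trans (pow-adjacent a≢b (MinSize-contraction≤suc ΔN N∖0-size N/0-size)
                                         (MinSize-deletion≤suc ΔN N∖0-size N/0-size))
                       (cong (λ k → - (-[1+ 1 ] ^ k)) (sym (d-∗̄₀-≢ {N = N} N∖0-size N/0-size a≢b)))

Q₁Formula : SetSystem n → Set
Q₁Formula {n} M = q₁ M (-[1+ 1 ]) ≡ (-[1+ 0 ] ^ n) * (-[1+ 1 ] ^ d (M ∗̄V))

Q₁Formula-one-slice : {M : SetSystem (suc n)} (K : SetSystem n) →
                      q₁ M -[1+ 1 ] ≡ (1ℤ + -[1+ 1 ]) * q₁ K -[1+ 1 ] → d (M ∗̄V) ≡ d (K ∗̄V) →
                      Q₁Formula K → Q₁Formula M
Q₁Formula-one-slice {n} {M} K q₁≡ d≡ ih = begin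
  q₁ M -[1+ 1 ]                                ≡⟨ q₁≡ ⟩
  (1ℤ + -[1+ 1 ]) * q₁ K -[1+ 1 ]              ≡⟨ cong ((1ℤ + -[1+ 1 ]) *_) ih ⟩
  (1ℤ + -[1+ 1 ]) * (s * (-[1+ 1 ] ^ d (K ∗̄V))) ≡⟨ sign s _ ⟩
  (-[1+ 0 ] * s) * (-[1+ 1 ] ^ d (K ∗̄V))       ≡⟨ cong (λ k → (-[1+ 0 ] * s) * (-[1+ 1 ] ^ k)) (sym d≡) ⟩
  (-[1+ 0 ] * s) * (-[1+ 1 ] ^ d (M ∗̄V))       ∎
  where
  open ≡-Reasoning
  s : ℤ
  s = -[1+ 0 ] ^ n
  sign : ∀ s p → (1ℤ + -[1+ 1 ]) * (s * p) ≡ (-[1+ 0 ] * s) * p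
  sign = solve-∀

module _ {M : SetSystem (suc n)} (vf : IsVfClosedΔMatroid M) where

  -- By definition M ∗̄V is Q ∗̄ zero.
  private
    Q : SetSystem (suc n)
    Q = dualPivots M (tabulate suc)

    ΔQ : IsΔMatroid Q
    ΔQ = Δ-dualPivots vf (tabulate suc)

    MinSize-slice-Q : ∀ b → Proper (slice b M) → MinSize (slice b Q) (d (slice b M ∗̄V))
    MinSize-slice-Q b M/b-proper =
      subst (λ K → MinSize K (d (slice b M ∗̄V))) (sym (slice-dualPivots-others b M))
        (d-minSize _ (proj₁ (Δ-dualPivots (vf-slice b vf M/b-proper) (allFin n))))

    IsEmpty-slice-Q : ∀ b → IsEmpty (slice b M) → IsEmpty (slice b Q)
    IsEmpty-slice-Q b M/b=∅ =
      subst IsEmpty (sym (slice-dualPivots-others b M)) (IsEmpty-dualPivots (allFin n) M/b=∅)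

  Q₁Formula-slices : Proper (deletion M) → Proper (contraction M) →
                     Q₁Formula (deletion M) → Q₁Formula (contraction M) → Q₁Formula M
  Q₁Formula-slices M∖0-proper M/0-proper ih∖0 ih/0 = begin
    q₁ M -[1+ 1 ]                                          ≡⟨ q₁-slices (vf []) _ M∖0-proper M/0-proper ⟩
    q₁ (deletion M) -[1+ 1 ] + q₁ (contraction M) -[1+ 1 ] ≡⟨ cong₂ _+_ ih∖0 ih/0 ⟩
    s * (-[1+ 1 ] ^ d∖0) + s * (-[1+ 1 ] ^ d/0)            ≡⟨ sym (ℤ.*-distribˡ-+ s _ _) ⟩
    s * (-[1+ 1 ] ^ d∖0 + -[1+ 1 ] ^ d/0)                  ≡⟨ cong (s *_) (pow-d-∗̄₀ ΔQ Q∖0-size Q/0-size) ⟩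
    s * - (-[1+ 1 ] ^ d (M ∗̄V))                            ≡⟨ sign s _ ⟩
    (-[1+ 0 ] * s) * (-[1+ 1 ] ^ d (M ∗̄V))                 ∎
    where
    open ≡-Reasoning
    s : ℤ
    s = -[1+ 0 ] ^ n
    d∖0 d/0 : ℕ
    d∖0 = d (deletion M ∗̄V)
    d/0 = d (contraction M ∗̄V)
    Q∖0-size : MinSize (deletion Q) d∖0
    Q∖0-size = MinSize-slice-Q false M∖0-proper
    Q/0-size : MinSize (contraction Q) d/0
    Q/0-size = MinSize-slice-Q true M/0-proper
    sign : ∀ s p → s * - p ≡ (-[1+ 0 ] * s) * p
    sign = solve-∀

  Q₁Formula-contraction-empty : Proper (deletion M) → IsEmpty (contraction M) →
                                Q₁Formula (deletion M) → Q₁Formula M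
  Q₁Formula-contraction-empty M∖0-proper M/0=∅ =
    Q₁Formula-one-slice (deletion M) (q₁-contraction-empty (vf []) _ M∖0-proper M/0=∅)
      (d-∗̄₀-contraction-empty {N = Q} (MinSize-slice-Q false M∖0-proper) (IsEmpty-slice-Q true M/0=∅))

  Q₁Formula-deletion-empty : IsEmpty (deletion M) → Proper (contraction M) →
                             Q₁Formula (contraction M) → Q₁Formula M
  Q₁Formula-deletion-empty M∖0=∅ M/0-proper =
    Q₁Formula-one-slice (contraction M) (q₁-deletion-empty (vf []) _ M∖0=∅ M/0-proper)
      (d-∗̄₀-deletion-empty {N = Q} (IsEmpty-slice-Q false M∖0=∅) (MinSize-slice-Q true M/0-proper))

theorem27 : (n : ℕ) (M : SetSystem n) → IsVfClosedΔMatroid M →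
    q₁ M (-[1+ 1 ]) ≡ (-[1+ 0 ] ^ n) * (-[1+ 1 ] ^ d (M ∗̄V))
theorem27 zero    M vf = trans (ℤ.+-identityʳ _) (sym (ℤ.*-identityˡ _))
theorem27 (suc n) M vf with decProper (deletion M) | decProper (contraction M)
... | inj₁ M∖0-proper | inj₁ M/0-proper =
  Q₁Formula-slices vf M∖0-proper M/0-proper
    (theorem27 n _ (vf-slice false vf M∖0-proper)) (theorem27 n _ (vf-slice true vf M/0-proper))
... | inj₁ M∖0-proper | inj₂ M/0=∅ =
  Q₁Formula-contraction-empty vf M∖0-proper M/0=∅ (theorem27 n _ (vf-slice false vf M∖0-proper))
... | inj₂ M∖0=∅ | inj₁ M/0-proper =
  Q₁Formula-deletion-empty vf M∖0=∅ M/0-proper (theorem27 n _ (vf-slice true vf M/0-proper))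
... | inj₂ M∖0=∅ | inj₂ M/0=∅ = ⊥-elim (slices-empty⇒¬Proper M∖0=∅ M/0=∅ (proj₁ (vf [])))
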